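{- Let $I$ be an instance of SMC-1 in which every man's preference list has length at most $2$, and let $M_s$ be a fixed stable matching of $I$. Let $P_1$ and $P_2$ be vertex-disjoint augmenting paths with costs $c_1$ and $c_2$, respectively. Then the cost of $P_1\cup P_2$ is at most $c_1+c_2$. Moreover, if the cost of $P_1\cup P_2$ is less than $c_1+c_2$, then for some $\{i_1,i_2\}=\{1,2\}$ there is a special pair $\{m,w\}$ such that $P_{i_1}$ ends at $m$, $w$ lies on $P_{i_2}$, and $\{m,w\}$ is blocking for $M_s\triangle P_{i_2}$ but not blocking for $M_s\triangle(P_1\cup P_2)$.
   Context: An instance of SMC-1 consists of a finite set $\mathcal M$ of men, a finite set $\mathcal W$ of women, for each person $x$ a preference list $L(x)$ strictly ordering a subset of the opposite sex (acceptability is mutual), and a set $\mathcal W^\star\subseteq\mathcal W$ of distinguished women. A matching is a set of disjoint man–woman pairs of mutually acceptable persons; $M(x)$ is the partner of $x$. A pair $\{m,w\}$ of mutually acceptable persons is blocking for $M$ if $m$ is unmatched or prefers $w$ to $M(m)$, and $w$ is unmatched or prefers $m$ to $M(w)$; $M$ is stable if it has no blocking pair. $G$ is the bipartite graph on $\mathcal M\cup\mathcal W$ whose edges are the mutually acceptable pairs. Let $\mathcal W^\star_0$ be the distinguished women unmatched by $M_s$ and $\mathcal M_0$ the men unmatched by $M_s$. An augmenting path is a path $P$ in $G$ such that $M_s\triangle P$ (symmetric difference of edge sets) is a matching and one endpoint of $P$ lies in $\mathcal W^\star_0$ and the other endpoint is either in $\mathcal W^\star_0$ or not distinguished; it starts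 at its endpoint in $\mathcal W^\star_0$ and ends at its other endpoint. For a set $P$ of edges such that $M_s\triangle P$ is a matching, the cost of $P$ is the number of blocking pairs of $M_s\triangle P$. A pair $\{m,w\}$ is special if $m\in\mathcal M_0$ and $w$ is the second (less preferred) woman in $L(m)$. -}

module Defs where

open import Data.Nat using (ℕ; _≤_)
open import Data.Fin using (Fin)
open import Data.Fin.Properties using (all?) renaming (_≟_ to _≟F_)
open import Data.Bool using (Bool; true; false; if_then_else_; _∧_; _∨_; _xor_) renaming (_≟_ to _≟B_)
open import Data.List using (List; []; _∷_; length; filter; cartesianProduct; allFin; last; head)
open import Data.List.Membership.Propositional using (_∈_; _∉_)
open import Data.List.Relation.Unary.Any using (any?)
open import Data.List.Relation.Unary.Unique.Propositional using (Unique)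
open import Data.List.Relation.Unary.Linked using (Linked)
open import Data.Sum using (_⊎_; inj₁; inj₂)
open import Data.Product using (Σ; _×_; _,_; ∃)
open import Data.Maybe using (Maybe; just)
open import Data.Empty using (⊥)
open import Relation.Nullary using (Dec; ¬_)
open import Relation.Nullary.Decidable using (⌊_⌋; _×-dec_; _→-dec_)
open import Relation.Binary.PropositionalEquality using (_≡_)

-- An SMC-1 instance: men are Fin nM, women are Fin nW.
-- Preference lists are duplicate-free lists, most preferred first;
-- acceptability is mutual; dist w = true iff w is distinguished.
record Instance : Set where
  field
    nM nW : ℕ
    prefM : Fin nM → List (Fin nW)
    prefW : Fin nW → List (Fin nM)
    uniqM : ∀ m → Unique (prefM m)
    uniqW : ∀ w → Unique (prefW w)
    mutualAcc₁ : ∀ m w → w ∈ prefM m → m ∈ prefW w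
    mutualAcc₂ : ∀ m w → m ∈ prefW w → w ∈ prefM m
    dist : Fin nW → Bool

_∈F?_ : ∀ {k} (x : Fin k) (xs : List (Fin k)) → Dec (x ∈ xs)
x ∈F? xs = any? (x ≟F_) xs

module _ (I : Instance) where
  open Instance I

  EdgeSet : Set
  EdgeSet = Fin nM → Fin nW → Bool

  _△_ : EdgeSet → EdgeSet → EdgeSet
  (E △ F) m w = E m w xor F m w

  _∪E_ : EdgeSet → EdgeSet → EdgeSet
  (E ∪E F) m w = E m w ∨ F m w

  Acceptable : Fin nM → Fin nW → Set
  Acceptable m w = w ∈ prefM m

  IsMatching : EdgeSet → Set
  IsMatching E =
    (∀ m w → E m w ≡ true → Acceptable m w) ×
    (∀ m w w' → E m w ≡ true → E m w' ≡ true → w ≡ w') ×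
    (∀ m m' w → E m w ≡ true → E m' w ≡ true → m ≡ m')

  before : ∀ {k} → List (Fin k) → Fin k → Fin k → Bool
  before [] a b = false
  before (x ∷ xs) a b =
    if ⌊ x ≟F a ⌋ then ⌊ b ∈F? xs ⌋
    else (if ⌊ x ≟F b ⌋ then false else before xs a b)

  Blocking : EdgeSet → Fin nM → Fin nW → Set
  Blocking E m w =
    Acceptable m w ×
    (∀ w' → E m w' ≡ true → before (prefM m) w w' ≡ true) ×
    (∀ m' → E m' w ≡ true → before (prefW w) m m' ≡ true)

  blocking? : ∀ E m w → Dec (Blocking E m w)
  blocking? E m w =
    (w ∈F? prefM m) ×-dec
    (all? (λ w' → (E m w' ≟B true) →-dec (before (prefM m) w w' ≟B true)) ×-dec
     all? (λ m' → (E m' w ≟B true) →-dec (before (prefW w) m m' ≟B true)))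

  IsStable : EdgeSet → Set
  IsStable E = IsMatching E × (∀ m w → ¬ Blocking E m w)

  numBlocking : EdgeSet → ℕ
  numBlocking E =
    length (filter (λ p → blocking? E (Data.Product.proj₁ p) (Data.Product.proj₂ p))
                   (cartesianProduct (allFin nM) (allFin nW)))

  cost : EdgeSet → EdgeSet → ℕ
  cost Ms P = numBlocking (Ms △ P)

  Vertex : Set
  Vertex = Fin nM ⊎ Fin nW

  Adj : Vertex → Vertex → Set
  Adj (inj₁ m) (inj₂ w) = Acceptable m w
  Adj (inj₂ w) (inj₁ m) = Acceptable m w
  Adj (inj₁ _) (inj₁ _) = ⊥
  Adj (inj₂ _) (inj₂ _) = ⊥

  isEdge : Vertex → Vertex → Fin nM → Fin nW → Bool
  isEdge (inj₁ m') (inj₂ w') m w = ⌊ m ≟F m' ⌋ ∧ ⌊ w ≟F w' ⌋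
  isEdge (inj₂ w') (inj₁ m') m w = ⌊ m ≟F m' ⌋ ∧ ⌊ w ≟F w' ⌋
  isEdge (inj₁ _) (inj₁ _) m w = false
  isEdge (inj₂ _) (inj₂ _) m w = false

  pathE : List Vertex → EdgeSet
  pathE (x ∷ y ∷ rest) m w = isEdge x y m w ∨ pathE (y ∷ rest) m w
  pathE _ m w = false

  IsPathG : List Vertex → Set
  IsPathG vs = (Σ Vertex λ v → head vs ≡ just v) × Unique vs × Linked Adj vs

  UnmatchedW : EdgeSet → Fin nW → Set
  UnmatchedW E w = ∀ m → E m w ≡ false

  UnmatchedM : EdgeSet → Fin nM → Set
  UnmatchedM E m = ∀ w → E m w ≡ false

  InW0 : EdgeSet → Fin nW → Set
  InW0 Ms w = dist w ≡ true × UnmatchedW Ms w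

  IsAugmenting : EdgeSet → List Vertex → Set
  IsAugmenting Ms vs =
    IsPathG vs ×
    IsMatching (Ms △ pathE vs) ×
    (Σ (Fin nW) λ w → head vs ≡ just (inj₂ w) × InW0 Ms w) ×
    ((Σ (Fin nM) λ m → last vs ≡ just (inj₁ m)) ⊎
     (Σ (Fin nW) λ w → last vs ≡ just (inj₂ w) × (InW0 Ms w ⊎ dist w ≡ false)))

  VertexDisjoint : List Vertex → List Vertex → Set
  VertexDisjoint vs us = ∀ v → v ∈ vs → v ∉ us

  Special : EdgeSet → Fin nM → Fin nW → Set
  Special Ms m w = UnmatchedM Ms m × (Σ (Fin nW) λ w₁ → prefM m ≡ w₁ ∷ w ∷ [])

  -- the "moreover" witness for the ordered choice (P_{i1}, P_{i2}) = (vs, us)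
  Witness : EdgeSet → List Vertex → List Vertex → Set
  Witness Ms vs us =
    Σ (Fin nM) λ m → Σ (Fin nW) λ w →
      Special Ms m w ×
      last vs ≡ just (inj₁ m) ×
      inj₂ w ∈ us ×
      Blocking (Ms △ pathE us) m w ×
      ¬ Blocking (Ms △ (pathE vs ∪E pathE us)) m w

-- Compare blocking pairs one pair {m,w} at a time.  If neither m nor w lies on P₂, the pair
-- sees the same edges in M_s △ (P₁ ∪ P₂) as in M_s △ P₁ and the same as in M_s in
-- M_s △ P₂, so it blocks the union iff it blocks M_s △ P₁ and never blocks M_s △ P₂.
-- Symmetrically if neither lies on P₁.  The remaining case is m on P₁ and w on P₂ (or
-- vice versa).  Along an augmenting path every man gets a new partner b ≠ w, so if m
-- finds w acceptable then L(m) = {b, w}, m is unmatched in M_s and hence ends P₁.  Then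
-- {m,w} cannot block M_s △ P₁ (it would block M_s), blocks M_s △ P₂ if it blocks the
-- union, and if it blocks M_s △ P₂ but not the union, m prefers b to w, so L(m) = [b, w]
-- and {m,w} is special.  Summing over all pairs gives both claims.
module Submission where

open import Defs
open import Data.Bool using (true; false; _∨_; _xor_)
open import Data.Bool.Properties using (∨-identityʳ; ∨-zeroʳ; ∨-comm; xor-identityʳ; ¬-not)
open import Data.Empty using (⊥-elim)
open import Data.Fin using (Fin)
open import Data.Fin.Properties using () renaming (_≟_ to _≟F_)
open import Data.List using (List; []; _∷_; length; filter; last; cartesianProduct; allFin)
import Data.List.Membership.DecPropositional as DecMembership
open import Data.List.Membership.Propositional using (_∈_; _∉_)
open import Data.List.Relation.Unary.All.Properties using (All¬⇒¬Any)
open import Data.List.Relation.Unary.AllPairs using (_∷_)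
open import Data.List.Relation.Unary.Any using (here; there)
open import Data.List.Relation.Unary.Linked using (Linked; _∷_)
open import Data.List.Relation.Unary.Unique.Propositional using (Unique)
open import Data.Maybe using (just)
open import Data.Nat using (_≤_; _<_; _+_; z≤n; s≤s)
open import Data.Nat.Properties using (+-suc; ≤-pred; m≤n⇒m≤1+n)
open import Data.Product using (∃; _×_; _,_; proj₁; proj₂)
import Data.Product as Product
open import Data.Sum using (_⊎_; inj₁; inj₂; [_,_])
import Data.Sum as Sum
open import Data.Sum.Properties using (≡-dec)
open import Function using (_∘_)
open import Level using (Level)
open import Relation.Binary.PropositionalEquality using (_≡_; _≢_; refl; sym; trans; cong)
open import Relation.Nullary using (¬_; yes; no; contradiction)
open import Relation.Nullary.Decidable using (⌊_⌋; dec-true; isYes≗does)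
open import Relation.Unary using (Pred; Decidable)

module _ {a p : Level} {A : Set a} {R P Q : Pred A p}
         (R? : Decidable R) (P? : Decidable P) (Q? : Decidable Q) where

  length-filter-≤-+ : (∀ {x} → R x → P x ⊎ Q x) → ∀ xs →
    length (filter R? xs) ≤ length (filter P? xs) + length (filter Q? xs)
  length-filter-≤-+ R⊆P∪Q [] = z≤n
  length-filter-≤-+ R⊆P∪Q (x ∷ xs) with ih ← length-filter-≤-+ R⊆P∪Q xs | R? x | P? x | Q? x
  ... | yes Rx | no ¬Px | no ¬Qx = ⊥-elim ([ ¬Px , ¬Qx ] (R⊆P∪Q Rx))
  ... | yes _ | yes _ | no _ = s≤s ih
  ... | no _ | yes _ | no _ = m≤n⇒m≤1+n ih
  ... | no _ | no _ | no _ = ih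
  ... | yes _ | yes _ | yes _
    rewrite +-suc (length (filter P? xs)) (length (filter Q? xs)) = s≤s (m≤n⇒m≤1+n ih)
  ... | yes _ | no _ | yes _
    rewrite +-suc (length (filter P? xs)) (length (filter Q? xs)) = s≤s ih
  ... | no _ | yes _ | yes _
    rewrite +-suc (length (filter P? xs)) (length (filter Q? xs)) = m≤n⇒m≤1+n (m≤n⇒m≤1+n ih)
  ... | no _ | no _ | yes _
    rewrite +-suc (length (filter P? xs)) (length (filter Q? xs)) = m≤n⇒m≤1+n ih

  length-filter-<-+⇒∃ : (∀ {x} → R x → P x ⊎ Q x) → (∀ {x} → P x → ¬ Q x) → ∀ xs →
    length (filter R? xs) < length (filter P? xs) + length (filter Q? xs) →
    ∃ λ x → (P x ⊎ Q x) × ¬ R x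
  length-filter-<-+⇒∃ R⊆P∪Q P#Q (x ∷ xs) lt with R? x | P? x | Q? x
  ... | _ | yes Px | yes Qx = contradiction Qx (P#Q Px)
  ... | yes Rx | no ¬Px | no ¬Qx = ⊥-elim ([ ¬Px , ¬Qx ] (R⊆P∪Q Rx))
  ... | no ¬Rx | yes Px | no _ = x , inj₁ Px , ¬Rx
  ... | no ¬Rx | no _ | yes Qx = x , inj₂ Qx , ¬Rx
  ... | no _ | no _ | no _ = length-filter-<-+⇒∃ R⊆P∪Q P#Q xs lt
  ... | yes _ | yes _ | no _ = length-filter-<-+⇒∃ R⊆P∪Q P#Q xs (≤-pred lt)
  ... | yes _ | no _ | yes _
    rewrite +-suc (length (filter P? xs)) (length (filter Q? xs)) =
      length-filter-<-+⇒∃ R⊆P∪Q P#Q xs (≤-pred lt)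

module _ {a : Level} {A : Set a} where

  ∈-pair : ∀ {x y z : A} → z ∈ x ∷ y ∷ [] → z ≡ x ⊎ z ≡ y
  ∈-pair (here z≡x) = inj₁ z≡x
  ∈-pair (there (here z≡y)) = inj₂ z≡y

  length≤2-pair : ∀ {x y : A} {xs : List A} → length xs ≤ 2 → x ∈ xs → y ∈ xs → x ≢ y →
    xs ≡ x ∷ y ∷ [] ⊎ xs ≡ y ∷ x ∷ []
  length≤2-pair {xs = _ ∷ []} _ (here refl) (here refl) x≢y = contradiction refl x≢y
  length≤2-pair {xs = _ ∷ _ ∷ []} _ x∈ y∈ x≢y with ∈-pair x∈ | ∈-pair y∈
  ... | inj₁ refl | inj₂ refl = inj₁ refl
  ... | inj₂ refl | inj₁ refl = inj₂ refl
  ... | inj₁ refl | inj₁ refl = contradiction refl x≢y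
  ... | inj₂ refl | inj₂ refl = contradiction refl x≢y
  length≤2-pair {xs = _ ∷ _ ∷ _ ∷ _} (s≤s (s≤s ())) _ _ _

  length≤2-∈ : ∀ {x y z : A} {xs : List A} → length xs ≤ 2 → x ∈ xs → y ∈ xs → x ≢ y →
    z ∈ xs → z ≡ x ⊎ z ≡ y
  length≤2-∈ len x∈ y∈ x≢y z∈ with length≤2-pair len x∈ y∈ x≢y
  ... | inj₁ refl = ∈-pair z∈
  ... | inj₂ refl = Sum.swap (∈-pair z∈)

-- For a fixed pair, B, B₁ and B₂ say that it blocks M_s △ (P₁ ∪ P₂), M_s △ P₁ and M_s △ P₂;
-- counted over all pairs, the fields give the two claims of the theorem.
record Splits (B B₁ B₂ W : Set) : Set where
  field
    cover : B → B₁ ⊎ B₂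
    disjoint : B₁ → ¬ B₂
    witness : B₁ ⊎ B₂ → ¬ B → W

only-first-splits : ∀ {B B₁ B₂ W} → (B → B₁) → (B₁ → B) → ¬ B₂ → Splits B B₁ B₂ W
only-first-splits B⇒B₁ B₁⇒B ¬B₂ = record
  { cover = inj₁ ∘ B⇒B₁
  ; disjoint = λ _ → ¬B₂
  ; witness = λ { (inj₁ b₁) ¬B → contradiction (B₁⇒B b₁) ¬B ; (inj₂ b₂) _ → contradiction b₂ ¬B₂ }
  }

Splits-swap : ∀ {B B₁ B₂ W B′} → (B′ → B) → (B → B′) → Splits B B₁ B₂ W → Splits B′ B₂ B₁ W
Splits-swap B′⇒B B⇒B′ s = record
  { cover = Sum.swap ∘ cover ∘ B′⇒B
  ; disjoint = λ b₂ b₁ → disjoint b₁ b₂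
  ; witness = λ b ¬B′ → witness (Sum.swap b) (¬B′ ∘ B⇒B′)
  }
  where open Splits s

Splits-mapᵂ : ∀ {B B₁ B₂ W W′} → (W → W′) → Splits B B₁ B₂ W → Splits B B₁ B₂ W′
Splits-mapᵂ W⇒W′ s = record { Splits s ; witness = λ b ¬B → W⇒W′ (Splits.witness s b ¬B) }

false≢true : false ≢ true
false≢true ()

∨-true : ∀ a {b} → a ∨ b ≡ true → a ≡ true ⊎ b ≡ true
∨-true true _ = inj₁ refl
∨-true false e = inj₂ e

≟-refl : ∀ {n} (i : Fin n) → ⌊ i ≟F i ⌋ ≡ true
≟-refl i = trans (isYes≗does (i ≟F i)) (dec-true (i ≟F i) refl)

module _ (I : Instance) where
  open Instance I

  private
    infixl 6 _⊕_
    _⊕_ : EdgeSet I → EdgeSet I → EdgeSet I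
    _⊕_ = _△_ I

  ⊕-new : ∀ S E {m w} → S m w ≡ false → E m w ≡ true → (S ⊕ E) m w ≡ true
  ⊕-new _ _ S≡ E≡ rewrite S≡ | E≡ = refl

  ⊕-falseʳ : ∀ S E {m w} → E m w ≡ false → (S ⊕ E) m w ≡ S m w
  ⊕-falseʳ S E {m} {w} E≡ rewrite E≡ = xor-identityʳ (S m w)

  ⊕-∪-falseʳ : ∀ S E F {m w} → F m w ≡ false → (S ⊕ _∪E_ I E F) m w ≡ (S ⊕ E) m w
  ⊕-∪-falseʳ S E F {m} {w} F≡ rewrite F≡ | ∨-identityʳ (E m w) = refl

  ⊕-∪-falseˡ : ∀ S E F {m w} → E m w ≡ false → (S ⊕ _∪E_ I E F) m w ≡ (S ⊕ F) m w
  ⊕-∪-falseˡ S E F E≡ rewrite E≡ = refl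

  ⊕-∪-comm : ∀ S E F m w → (S ⊕ _∪E_ I E F) m w ≡ (S ⊕ _∪E_ I F E) m w
  ⊕-∪-comm S E F m w = cong (S m w xor_) (∨-comm (E m w) (F m w))

  Blocking-anti : ∀ {E F m w} → (∀ w′ → F m w′ ≡ true → E m w′ ≡ true) →
    (∀ m′ → F m′ w ≡ true → E m′ w ≡ true) → Blocking I E m w → Blocking I F m w
  Blocking-anti row col (acc , prefers-w , prefers-m) =
    acc , (λ w′ → prefers-w w′ ∘ row w′) , (λ m′ → prefers-m m′ ∘ col m′)

  Blocking-resp : ∀ {E F m w} → (∀ w′ → E m w′ ≡ F m w′) → (∀ m′ → E m′ w ≡ F m′ w) →
    Blocking I E m w → Blocking I F m w
  Blocking-resp row col = Blocking-anti (λ w′ → trans (row w′)) (λ m′ → trans (col m′))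

  Blocking-unmatched : ∀ {E F m w} → UnmatchedM I F m →
    (∀ m′ → F m′ w ≡ true → E m′ w ≡ true) → Blocking I E m w → Blocking I F m w
  Blocking-unmatched free =
    Blocking-anti (λ w′ Fmw′ → contradiction (trans (sym (free w′)) Fmw′) false≢true)

  before-pair : ∀ {k} (x y : Fin k) → before I (x ∷ y ∷ []) x y ≡ true
  before-pair x y rewrite ≟-refl x =
    trans (isYes≗does (y ∈F? (y ∷ []))) (dec-true (y ∈F? (y ∷ [])) (here refl))

  pathE-mw : ∀ m w vs → pathE I (inj₁ m ∷ inj₂ w ∷ vs) m w ≡ true
  pathE-mw m w _ rewrite ≟-refl m | ≟-refl w = refl

  pathE-wm : ∀ w m vs → pathE I (inj₂ w ∷ inj₁ m ∷ vs) m w ≡ true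
  pathE-wm w m _ rewrite ≟-refl m | ≟-refl w = refl

  isEdge-endpoints : ∀ x y vs {m w} → isEdge I x y m w ≡ true →
    inj₁ m ∈ x ∷ y ∷ vs × inj₂ w ∈ x ∷ y ∷ vs
  isEdge-endpoints (inj₁ m′) (inj₂ w′) _ {m} {w} e with m ≟F m′ | w ≟F w′
  ... | yes refl | yes refl = here refl , there (here refl)
  isEdge-endpoints (inj₁ _) (inj₂ _) _ () | yes _ | no _
  isEdge-endpoints (inj₁ _) (inj₂ _) _ () | no _ | _
  isEdge-endpoints (inj₂ w′) (inj₁ m′) _ {m} {w} e with m ≟F m′ | w ≟F w′
  ... | yes refl | yes refl = there (here refl) , here refl
  isEdge-endpoints (inj₂ _) (inj₁ _) _ () | yes _ | no _
  isEdge-endpoints (inj₂ _) (inj₁ _) _ () | no _ | _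

  pathE-tail : ∀ x y vs m w → pathE I (y ∷ vs) m w ≡ true → pathE I (x ∷ y ∷ vs) m w ≡ true
  pathE-tail x y _ m w e = trans (cong (isEdge I x y m w ∨_) e) (∨-zeroʳ _)

  pathE-endpoints : ∀ vs {m w} → pathE I vs m w ≡ true → inj₁ m ∈ vs × inj₂ w ∈ vs
  pathE-endpoints (x ∷ y ∷ vs) {m} {w} e =
    [ isEdge-endpoints x y vs , Product.map there there ∘ pathE-endpoints (y ∷ vs) ]
      (∨-true (isEdge I x y m w) e)

  pathE-∉ᵐ : ∀ vs {m} w → inj₁ m ∉ vs → pathE I vs m w ≡ false
  pathE-∉ᵐ vs w m∉ = ¬-not (m∉ ∘ proj₁ ∘ pathE-endpoints vs)

  pathE-∉ʷ : ∀ vs m {w} → inj₂ w ∉ vs → pathE I vs m w ≡ false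
  pathE-∉ʷ vs m w∉ = ¬-not (w∉ ∘ proj₂ ∘ pathE-endpoints vs)

  Alternates : EdgeSet I → EdgeSet I → List (Vertex I) → Fin nM → Set
  Alternates S E vs m =
    (∃ λ b → E m b ≡ true × S m b ≡ false) × (UnmatchedM I S m → last vs ≡ just (inj₁ m))

  module _ {S E : EdgeSet I} (S-matching : IsMatching I S) (S⊕E-matching : IsMatching I (S ⊕ E)) where

    alternates : ∀ w vs → (∀ m w′ → pathE I (inj₂ w ∷ vs) m w′ ≡ true → E m w′ ≡ true) →
      Unique (inj₂ w ∷ vs) → Linked (Adj I) (inj₂ w ∷ vs) →
      (∀ m → S m w ≡ true → inj₁ m ∉ vs) →
      ∀ m → inj₁ m ∈ vs → Alternates S E (inj₂ w ∷ vs) m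
    alternates w (inj₂ _ ∷ _) _ _ (() ∷ _) _ _ _
    alternates w (inj₁ _ ∷ inj₁ _ ∷ _) _ _ (_ ∷ () ∷ _) _ _ _
    alternates w (inj₁ m₀ ∷ []) path⊆E _ _ later m (here refl) =
      (w , path⊆E m₀ w (pathE-wm w m₀ []) , ¬-not λ Sm₀w → later m₀ Sm₀w (here refl)) ,
      λ _ → refl
    alternates w (inj₁ m₀ ∷ inj₂ w′ ∷ vs) path⊆E (w∉ ∷ m₀∉ ∷ unique) (_ ∷ _ ∷ linked) later m m∈ =
      go m∈
      where
      Em₀w : E m₀ w ≡ true
      Em₀w = path⊆E m₀ w (pathE-wm w m₀ (inj₂ w′ ∷ vs))

      Sm₀w : S m₀ w ≡ false
      Sm₀w = ¬-not λ Sm₀w → later m₀ Sm₀w (here refl)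

      -- Otherwise m₀ would have the two partners w and w′ in S ⊕ E.
      Sm₀w′ : S m₀ w′ ≡ true
      Sm₀w′ = ¬-not λ Sm₀w′ → All¬⇒¬Any w∉ (there (here (cong inj₂
        (proj₁ (proj₂ S⊕E-matching) m₀ w w′ (⊕-new S E Sm₀w Em₀w)
          (⊕-new S E Sm₀w′ (path⊆E m₀ w′
          (pathE-tail (inj₂ w) (inj₁ m₀) (inj₂ w′ ∷ vs) m₀ w′ (pathE-mw m₀ w′ vs))))))))

      later′ : ∀ m′ → S m′ w′ ≡ true → inj₁ m′ ∉ vs
      later′ m′ Sm′w′ m′∈ with proj₂ (proj₂ S-matching) m′ m₀ w′ Sm′w′ Sm₀w′
      ... | refl = All¬⇒¬Any m₀∉ (there m′∈)

      go : inj₁ m ∈ inj₁ m₀ ∷ inj₂ w′ ∷ vs → Alternates S E (inj₂ w ∷ inj₁ m₀ ∷ inj₂ w′ ∷ vs) m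
      go (here refl) =
        (w , Em₀w , Sm₀w) , λ free → contradiction (trans (sym (free w′)) Sm₀w′) false≢true
      go (there (there m∈vs)) =
        alternates w′ vs
          (λ m″ w″ e → path⊆E m″ w″ (pathE-tail (inj₂ w) (inj₁ m₀) (inj₂ w′ ∷ vs) m″ w″
            (pathE-tail (inj₁ m₀) (inj₂ w′) vs m″ w″ e)))
          unique linked later′ m m∈vs

  augmenting-alternates : ∀ {S vs} → IsMatching I S → IsAugmenting I S vs →
    ∀ m → inj₁ m ∈ vs → Alternates S (pathE I vs) vs m
  augmenting-alternates {vs = []} _ (_ , _ , (_ , () , _) , _)
  augmenting-alternates {vs = _ ∷ vs} S-matching
    ((_ , unique , linked) , S⊕P-matching , (w₀ , refl , _ , w₀-free) , _) m (there m∈) =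
    alternates S-matching S⊕P-matching w₀ vs (λ _ _ e → e) unique linked
      (λ m′ Sm′w₀ _ → contradiction (trans (sym (w₀-free m′)) Sm′w₀) false≢true) m m∈

  module Crossing (len≤2 : ∀ m → length (prefM m) ≤ 2) {S : EdgeSet I} (S-stable : IsStable I S)
    {P Q : List (Vertex I)} (P-augmenting : IsAugmenting I S P) (P#Q : VertexDisjoint I P Q) where

    MP MQ U : EdgeSet I
    MP = S ⊕ pathE I P
    MQ = S ⊕ pathE I Q
    U = S ⊕ _∪E_ I (pathE I P) (pathE I Q)

    S-matching : IsMatching I S
    S-matching = proj₁ S-stable

    off-Q-splits : ∀ {m w W} → inj₁ m ∉ Q → inj₂ w ∉ Q →
      Splits (Blocking I U m w) (Blocking I MP m w) (Blocking I MQ m w) W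
    off-Q-splits {m} {w} m∉Q w∉Q =
      only-first-splits (Blocking-resp U-row U-col)
        (Blocking-resp (sym ∘ U-row) (sym ∘ U-col))
        (proj₂ S-stable m w ∘ Blocking-resp MQ-row MQ-col)
      where
      U-row : ∀ w′ → U m w′ ≡ MP m w′
      U-row w′ = ⊕-∪-falseʳ S (pathE I P) (pathE I Q) (pathE-∉ᵐ Q w′ m∉Q)
      U-col : ∀ m′ → U m′ w ≡ MP m′ w
      U-col m′ = ⊕-∪-falseʳ S (pathE I P) (pathE I Q) (pathE-∉ʷ Q m′ w∉Q)
      MQ-row : ∀ w′ → MQ m w′ ≡ S m w′
      MQ-row w′ = ⊕-falseʳ S (pathE I Q) (pathE-∉ᵐ Q w′ m∉Q)
      MQ-col : ∀ m′ → MQ m′ w ≡ S m′ w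
      MQ-col m′ = ⊕-falseʳ S (pathE I Q) (pathE-∉ʷ Q m′ w∉Q)

    module CrossingPair {m w} (m∈P : inj₁ m ∈ P) (w∈Q : inj₂ w ∈ Q) where

      m∉Q : inj₁ m ∉ Q
      m∉Q = P#Q _ m∈P

      w∉P : inj₂ w ∉ P
      w∉P w∈P = P#Q _ w∈P w∈Q

      MP-col : ∀ m′ → MP m′ w ≡ S m′ w
      MP-col m′ = ⊕-falseʳ S (pathE I P) (pathE-∉ʷ P m′ w∉P)

      U-col : ∀ m′ → U m′ w ≡ MQ m′ w
      U-col m′ = ⊕-∪-falseˡ S (pathE I P) (pathE I Q) (pathE-∉ʷ P m′ w∉P)

      alternation : Alternates S (pathE I P) P m
      alternation = augmenting-alternates S-matching P-augmenting m m∈P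

      b : Fin nW
      b = proj₁ (proj₁ alternation)

      Pmb : pathE I P m b ≡ true
      Pmb = proj₁ (proj₂ (proj₁ alternation))

      Smb : S m b ≡ false
      Smb = proj₂ (proj₂ (proj₁ alternation))

      MPmb : MP m b ≡ true
      MPmb = ⊕-new S (pathE I P) Smb Pmb

      MP-partner : ∀ {w′} → MP m w′ ≡ true → w′ ≡ b
      MP-partner {w′} MPmw′ = proj₁ (proj₂ (proj₁ (proj₂ P-augmenting))) m w′ b MPmw′ MPmb

      b∈L : b ∈ prefM m
      b∈L = proj₁ (proj₁ (proj₂ P-augmenting)) m b MPmb

      b≢w : b ≢ w
      b≢w refl = w∉P (proj₂ (pathE-endpoints P Pmb))

      -- L(m) = {b, w}, and S matches m to neither of them.
      free : Acceptable I m w → UnmatchedM I S m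
      free w∈L w′ = ¬-not λ Smw′ →
        [ (λ { refl → false≢true (trans (sym Smb) Smw′) })
        , (λ { refl → b≢w (sym (MP-partner (trans (MP-col m) Smw′))) })
        ] (length≤2-∈ (len≤2 m) b∈L w∈L b≢w (proj₁ S-matching m w′ Smw′))

      ¬MP : ¬ Blocking I MP m w
      ¬MP blocks = proj₂ S-stable m w
        (Blocking-unmatched (free (proj₁ blocks)) (λ m′ → trans (MP-col m′)) blocks)

      U⇒MQ : Blocking I U m w → Blocking I MQ m w
      U⇒MQ blocks = Blocking-unmatched
        (λ w′ → trans (⊕-falseʳ S (pathE I Q) (pathE-∉ᵐ Q w′ m∉Q)) (free (proj₁ blocks) w′))
        (λ m′ → trans (U-col m′)) blocks

      -- If L(m) = [w, b], then m prefers w to his partner b in U, so {m,w} blocks U.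
      MQ⇒U-or-special : Blocking I MQ m w → ¬ Blocking I U m w → Witness I S P Q
      MQ⇒U-or-special blocks@(w∈L , _ , prefers-m) ¬U with length≤2-pair (len≤2 m) b∈L w∈L b≢w
      ... | inj₁ L≡bw =
        m , w , (free w∈L , b , L≡bw) , proj₂ alternation (free w∈L) , w∈Q , blocks , ¬U
      ... | inj₂ L≡wb = ⊥-elim (¬U (w∈L , prefers-w , λ m′ → prefers-m m′ ∘ trans (sym (U-col m′))))
        where
        prefers-w : ∀ w′ → U m w′ ≡ true → before I (prefM m) w w′ ≡ true
        prefers-w w′ Umw′
          with refl ← MP-partner (trans (sym (⊕-∪-falseʳ S (pathE I P) (pathE I Q) (pathE-∉ᵐ Q w′ m∉Q))) Umw′)
          rewrite L≡wb = before-pair w b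

    crossing-splits : ∀ {m w} → inj₁ m ∈ P → inj₂ w ∈ Q →
      Splits (Blocking I U m w) (Blocking I MP m w) (Blocking I MQ m w) (Witness I S P Q)
    crossing-splits m∈P w∈Q = record
      { cover = inj₂ ∘ U⇒MQ
      ; disjoint = λ b₁ _ → ¬MP b₁
      ; witness = λ { (inj₁ b₁) _ → contradiction b₁ ¬MP ; (inj₂ b₂) ¬U → MQ⇒U-or-special b₂ ¬U }
      }
      where open CrossingPair m∈P w∈Q

  module _ (len≤2 : ∀ m → length (prefM m) ≤ 2) {S : EdgeSet I} (S-stable : IsStable I S)
    {P₁ P₂ : List (Vertex I)} (P₁-augmenting : IsAugmenting I S P₁) (P₂-augmenting : IsAugmenting I S P₂)
    (P₁#P₂ : VertexDisjoint I P₁ P₂) where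

    private
      module C₁₂ = Crossing len≤2 S-stable P₁-augmenting P₁#P₂
      module C₂₁ = Crossing len≤2 S-stable P₂-augmenting (λ v v∈P₂ v∈P₁ → P₁#P₂ v v∈P₁ v∈P₂)
      open DecMembership (≡-dec (_≟F_ {nM}) (_≟F_ {nW})) using (_∈?_)

      swap-union : ∀ {m w W} →
        Splits (Blocking I C₂₁.U m w) (Blocking I C₁₂.MQ m w) (Blocking I C₁₂.MP m w) W →
        Splits (Blocking I C₁₂.U m w) (Blocking I C₁₂.MP m w) (Blocking I C₁₂.MQ m w) W
      swap-union {m} {w} = Splits-swap (Blocking-resp (comm P₁ P₂ m) (λ m′ → comm P₁ P₂ m′ w))
                                       (Blocking-resp (comm P₂ P₁ m) (λ m′ → comm P₂ P₁ m′ w))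
        where comm = λ Pᵢ Pⱼ → ⊕-∪-comm S (pathE I Pᵢ) (pathE I Pⱼ)

    pair-splits : ∀ m w → Splits (Blocking I C₁₂.U m w) (Blocking I C₁₂.MP m w) (Blocking I C₁₂.MQ m w)
      (Witness I S P₁ P₂ ⊎ Witness I S P₂ P₁)
    pair-splits m w with inj₁ m ∈? P₁
    pair-splits m w | yes m∈P₁ with inj₂ w ∈? P₂
    ... | yes w∈P₂ = Splits-mapᵂ inj₁ (C₁₂.crossing-splits m∈P₁ w∈P₂)
    ... | no w∉P₂ = C₁₂.off-Q-splits (P₁#P₂ _ m∈P₁) w∉P₂
    pair-splits m w | no m∉P₁ with inj₂ w ∈? P₁
    ... | no w∉P₁ = swap-union (C₂₁.off-Q-splits m∉P₁ w∉P₁)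
    ... | yes w∈P₁ with inj₁ m ∈? P₂
    ...   | yes m∈P₂ = swap-union (Splits-mapᵂ inj₂ (C₂₁.crossing-splits m∈P₂ w∈P₁))
    ...   | no m∉P₂ = C₁₂.off-Q-splits m∉P₂ (P₁#P₂ _ w∈P₁)

lemma1 : (I : Instance) →
    (∀ m → length (Instance.prefM I m) ≤ 2) →
    (Ms : EdgeSet I) → IsStable I Ms →
    (P₁ P₂ : List (Vertex I)) →
    IsAugmenting I Ms P₁ → IsAugmenting I Ms P₂ →
    VertexDisjoint I P₁ P₂ →
    (cost I Ms (_∪E_ I (pathE I P₁) (pathE I P₂))
        ≤ cost I Ms (pathE I P₁) + cost I Ms (pathE I P₂))
    × (cost I Ms (_∪E_ I (pathE I P₁) (pathE I P₂))
          < cost I Ms (pathE I P₁) + cost I Ms (pathE I P₂) →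
       Witness I Ms P₁ P₂ ⊎ Witness I Ms P₂ P₁)
lemma1 I len≤2 Ms Ms-stable P₁ P₂ P₁-augmenting P₂-augmenting P₁#P₂ =
  length-filter-≤-+ blocks? blocks₁? blocks₂? (cover (splits _)) pairs ,
  λ lt → let ((m , w) , b , ¬B) = length-filter-<-+⇒∃ blocks? blocks₁? blocks₂?
                                     (cover (splits _)) (disjoint (splits _)) pairs lt
         in witness (splits (m , w)) b ¬B
  where
  open Instance I using (nM; nW)
  open Splits
  pairs = cartesianProduct (allFin nM) (allFin nW)
  splits = λ (p : Fin nM × Fin nW) →
    pair-splits I len≤2 Ms-stable P₁-augmenting P₂-augmenting P₁#P₂ (proj₁ p) (proj₂ p)
  blocks? = λ (p : Fin nM × Fin nW) →
    blocking? I (_△_ I Ms (_∪E_ I (pathE I P₁) (pathE I P₂))) (proj₁ p) (proj₂ p)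
  blocks₁? = λ (p : Fin nM × Fin nW) → blocking? I (_△_ I Ms (pathE I P₁)) (proj₁ p) (proj₂ p)
  blocks₂? = λ (p : Fin nM × Fin nW) → blocking? I (_△_ I Ms (pathE I P₂)) (proj₁ p) (proj₂ p)
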